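{- Let $H=((Q,S),E)$ be a split graph with $\sigma(H)=2$, with no pendant vertices, which is not overfull, has an odd number $n=|V(H)|$ of vertices, and has a vertex $s_1\in S$ with $\delta(H)=d(s_1)\leq \frac{n-1}{2}$. Then the following construction can be carried out: make $V(H)\setminus\{s_1\}$ into a clique $Q^*$ (adding all missing edges among these vertices), and then add edges between $s_1$ and vertices of $Q^*$ until the total number of edges equals $\Delta(H)\cdot\lfloor n/2\rfloor$. That is, there exists a graph $H^*$ on vertex set $V(H)$ containing all edges of $H$, in which $V(H)\setminus\{s_1\}$ is a clique, $s_1$ is adjacent only to vertices of this clique, $\Delta(H^*)=\Delta(H)$, and $|E(H^*)|=\Delta(H)\cdot\lfloor n/2\rfloor$.
   Context: A split graph $H=((Q,S),E)$ has vertex set partitioned into a (maximal) clique $Q$ and an independent set $S$. A pendant vertex is a vertex of degree $1$. The stretch index $\sigma(H)$ of a connected graph is the least $t$ such that $H$ has a spanning tree $T$ in which every pair of vertices adjacent in $H$ are at distance at most $t$ in $T$ (for split graphs without pendant vertices, $\sigma(H)=2$ holds exactly when $H$ has a universal vertex). $\Delta(H)$ and $\delta(H)$ denote the maximum and minimum degree. A graph with $n$ vertices is overfull if $|E|>\Delta\cdot\lfloor n/2\rfloor$. -}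

module Defs where

open import Data.Nat using (ℕ; zero; suc; _+_; _*_; _∸_; _≤_; _<_; _⊔_)
open import Data.Nat.DivMod using (_/_; _%_)
open import Data.Fin using (Fin; toℕ)
open import Data.Bool using (Bool; true; false; if_then_else_)
open import Data.Nat.ListAction using (sum)
open import Data.List using (List; map; allFin; foldr; concatMap)
open import Data.Product using (Σ; ∃; _×_; _,_)
open import Data.Sum using (_⊎_)
open import Relation.Binary.PropositionalEquality using (_≡_; _≢_)
open import Relation.Nullary using (¬_)
open import Relation.Nullary.Decidable using (⌊_⌋)
open import Data.Nat using (_<?_)

record Graph (n : ℕ) : Set where
  field
    adj   : Fin n → Fin n → Bool
    sym   : ∀ u v → adj u v ≡ adj v u
    irref : ∀ v → adj v v ≡ false
open Graph public

deg : ∀ {n} → Graph n → Fin n → ℕ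
deg {n} G v = sum (map (λ u → if adj G v u then 1 else 0) (allFin n))

edges : ∀ {n} → Graph n → ℕ
edges {n} G =
  sum (concatMap (λ i → map (λ j → if ⌊ toℕ i <? toℕ j ⌋ then (if adj G i j then 1 else 0) else 0)
                            (allFin n))
                 (allFin n))

maxDeg : ∀ {n} → Graph n → ℕ
maxDeg {n} G = foldr _⊔_ 0 (map (deg G) (allFin n))

Overfull : ∀ {n} → Graph n → Set
Overfull {n} G = maxDeg G * (n / 2) < edges G

record SplitPartition {n : ℕ} (G : Graph n) (inQ : Fin n → Bool) : Set where
  field
    clique      : ∀ u v → inQ u ≡ true → inQ v ≡ true → u ≢ v → adj G u v ≡ true
    independent : ∀ u v → inQ u ≡ false → inQ v ≡ false → adj G u v ≡ false
    maximal     : ∀ s → inQ s ≡ false → Σ (Fin n) λ q → inQ q ≡ true × adj G s q ≡ false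

_⊆ᴳ_ : ∀ {n} → Graph n → Graph n → Set
_⊆ᴳ_ {n} T G = ∀ u v → adj T u v ≡ true → adj G u v ≡ true

-- Reach T k u v : dist_T(u,v) ≤ k  (a walk of length at most k in T)
Reach : ∀ {n} → Graph n → ℕ → Fin n → Fin n → Set
Reach T zero    u v = u ≡ v
Reach {n} T (suc k) u v = u ≡ v ⊎ Σ (Fin n) λ w → adj T u w ≡ true × Reach T k w v

Connected : ∀ {n} → Graph n → Set
Connected {n} G = ∀ u v → ∃ λ k → Reach G k u v

IsSpanningTree : ∀ {n} → Graph n → Graph n → Set
IsSpanningTree {n} T G = (T ⊆ᴳ G) × Connected T × edges T ≡ n ∸ 1

StretchAtMost : ∀ {n} → Graph n → ℕ → Set
StretchAtMost {n} G t =
  Σ (Graph n) λ T → IsSpanningTree T G × (∀ u v → adj G u v ≡ true → Reach T t u v)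

StretchIndexTwo : ∀ {n} → Graph n → Set
StretchIndexTwo G = StretchAtMost G 2 × ¬ StretchAtMost G 1

-- A tree 2-spanner T of H forces a universal vertex. The clique Q is pairwise at T-distance
-- ≤ 2, so (rooting T at a vertex of Q) it lies in the closed T-star of a single vertex c, and
-- c ∈ Q by maximality of Q. Rooting T at c, a vertex s ∈ S hangs below a child p ∈ Q of c (or
-- below c itself); as s is not pendant it has a second neighbour in Q, a child of c too, and
-- that neighbour is at T-distance ≤ 2 from s only if it is c. Hence Δ(H) = n − 1.
-- The graph H* keeps a vertex of degree n − 1, and if s₁ is joined to exactly m = (n − 1)/2
-- vertices (its neighbours padded by further ones) then 2·|E(H*)| = 2m(2m − 1) + 2m = 2m·2m.

module Submission where

open import Defs renaming (sym to adj-sym)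

open import Algebra.Properties.Semiring.Sum using ()
open import Data.Bool using (Bool; true; false; if_then_else_; not; _∧_; _∨_)
import Data.Bool.Properties as Bool
open import Data.Empty using (⊥; ⊥-elim)
open import Data.Fin using (Fin; zero; suc; toℕ)
open import Data.Fin.Properties using (_≟_; toℕ-injective; any?; toℕ<n)
  renaming (suc-injective to Fin-suc-injective)
open import Data.List using (List; []; _∷_; map; allFin; tabulate; concatMap)
open import Data.List.Properties using (map-tabulate)
open import Data.List.Membership.Propositional using (_∈_)
open import Data.List.Membership.Propositional.Properties using (∈-map⁺; ∈-allFin)
open import Data.List.Relation.Unary.All using (All; []; _∷_)
import Data.List.Relation.Unary.All.Properties as All
open import Data.List.Relation.Unary.Any using (here; there)
open import Data.Nat using (ℕ; zero; suc; _+_; _*_; _∸_; _≤_; _<_; _⊔_; z≤n; s≤s; _<?_; _<ᵇ_; _≡ᵇ_)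
open import Data.Nat.DivMod using (_/_; _%_; m≡m%n+[m/n]*n)
import Data.Nat.ListAction as List
open import Data.Nat.ListAction.Properties using (sum-++)
open import Data.Nat.Properties hiding (_≟_)
open import Data.Nat.Tactic.RingSolver using (solve-∀)
open import Data.Product using (Σ; _×_; _,_; proj₁; proj₂)
open import Data.Sum using (_⊎_; inj₁; inj₂)
open import Function using (_∘_; id)
open import Function.Bundles using (mk⇔)
open import Relation.Binary.PropositionalEquality
open import Relation.Nullary using (Dec; yes; no; does; ¬_; ¬?)
open import Relation.Nullary.Decidable using (⌊_⌋; dec-true; dec-false; does-⇔; _×-dec_; _⊎-dec_)

open Algebra.Properties.Semiring.Sum +-*-semiring
  using (sum-syntax; sum-cong-≗; ∑-distrib-+; ∑-comm; *-distribʳ-sum; sum-replicate-zero)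

infix 4 _==_
_==_ : ∀ {n} → Fin n → Fin n → Bool
u == v = does (u ≟ v)

true≢false : true ≢ false
true≢false ()

==-sym : ∀ {n} (u v : Fin n) → (u == v) ≡ (v == u)
==-sym u v = does-⇔ (mk⇔ sym sym) (u ≟ v) (v ≟ u)

𝟙 : Bool → ℕ
𝟙 b = if b then 1 else 0

𝟙≤1 : ∀ b → 𝟙 b ≤ 1
𝟙≤1 true  = ≤-refl
𝟙≤1 false = z≤n

sum-tabulate : ∀ {n} (f : Fin n → ℕ) → List.sum (tabulate f) ≡ ∑[ i < n ] f i
sum-tabulate {zero}  f = refl
sum-tabulate {suc n} f = cong (f zero +_) (sum-tabulate (f ∘ suc))

sum-map-allFin : ∀ {n} (f : Fin n → ℕ) → List.sum (map f (allFin n)) ≡ ∑[ i < n ] f i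
sum-map-allFin f = trans (cong List.sum (map-tabulate id f)) (sum-tabulate f)

sum-concatMap : ∀ {A : Set} (F : A → List ℕ) xs →
                List.sum (concatMap F xs) ≡ List.sum (map (List.sum ∘ F) xs)
sum-concatMap F []       = refl
sum-concatMap F (x ∷ xs) = trans (sum-++ (F x) (concatMap F xs)) (cong (List.sum (F x) +_) (sum-concatMap F xs))

∑-mono-≤ : ∀ {n} {f g : Fin n → ℕ} → (∀ i → f i ≤ g i) → ∑[ i < n ] f i ≤ ∑[ i < n ] g i
∑-mono-≤ {zero}  f≤g = z≤n
∑-mono-≤ {suc n} f≤g = +-mono-≤ (f≤g zero) (∑-mono-≤ (f≤g ∘ suc))

∑-tight : ∀ {n} {f g : Fin n → ℕ} → (∀ i → f i ≤ g i) →
          ∑[ i < n ] f i ≡ ∑[ i < n ] g i → ∀ i → f i ≡ g i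
∑-tight {suc n} {f} {g} f≤g ∑f≡∑g i = go i
  where
  tail≤ : ∑[ i < n ] f (suc i) ≤ ∑[ i < n ] g (suc i)
  tail≤ = ∑-mono-≤ (f≤g ∘ suc)
  head≡ : f zero ≡ g zero
  head≡ = ≤-antisym (f≤g zero)
    (+-cancelʳ-≤ _ _ _ (≤-trans (≤-reflexive (sym ∑f≡∑g)) (+-monoʳ-≤ (f zero) tail≤)))
  go : ∀ i → f i ≡ g i
  go zero    = head≡
  go (suc i) = ∑-tight (f≤g ∘ suc) (+-cancelˡ-≡ (f zero) _ _ (trans ∑f≡∑g (cong (_+ _) (sym head≡)))) i

∑-pick : ∀ {n} (f : Fin n → ℕ) x → (∀ u → u ≢ x → f u ≡ 0) → ∑[ u < n ] f u ≡ f x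
∑-pick {suc n} f zero    f≡0 =
  trans (cong (f zero +_) (trans (sum-cong-≗ (λ u → f≡0 (suc u) λ ())) (sum-replicate-zero n))) (+-identityʳ _)
∑-pick {suc n} f (suc x) f≡0 =
  cong₂ _+_ (f≡0 zero λ ()) (∑-pick (f ∘ suc) x λ u u≢x → f≡0 (suc u) (u≢x ∘ Fin-suc-injective))

∑-scale : ∀ {n} (f : Fin n → ℕ) k → ∑[ i < n ] (f i * k) ≡ ∑[ i < n ] f i * k
∑-scale {n} f k = sym (*-distribʳ-sum {n} k f)

∑-const-1 : ∀ n → ∑[ i < n ] 1 ≡ n
∑-const-1 zero    = refl
∑-const-1 (suc n) = cong suc (∑-const-1 n)

𝟙+𝟙-not : ∀ b → 𝟙 b + 𝟙 (not b) ≡ 1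
𝟙+𝟙-not true  = refl
𝟙+𝟙-not false = refl

∑-𝟙-≡ : ∀ {n} (x : Fin n) → ∑[ u < n ] 𝟙 (u == x) ≡ 1
∑-𝟙-≡ x = trans (∑-pick _ x λ u u≢x → cong 𝟙 (dec-false (u ≟ x) u≢x)) (cong 𝟙 (dec-true (x ≟ x) refl))

∑-𝟙-≢ : ∀ {n} (x : Fin n) → ∑[ u < n ] 𝟙 (not (u == x)) ≡ n ∸ 1
∑-𝟙-≢ {n} x = begin
  ∑≢                        ≡⟨ m+n∸m≡n 1 ∑≢ ⟨
  1 + ∑≢ ∸ 1                ≡⟨ cong (λ k → k + ∑≢ ∸ 1) (∑-𝟙-≡ x) ⟨
  ∑[ u < n ] 𝟙 (u == x) + ∑≢ ∸ 1
    ≡⟨ cong (_∸ 1) (∑-distrib-+ {n} (λ u → 𝟙 (u == x)) (λ u → 𝟙 (not (u == x)))) ⟨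
  ∑[ u < n ] (𝟙 (u == x) + 𝟙 (not (u == x))) ∸ 1
    ≡⟨ cong (_∸ 1) (sum-cong-≗ {n} λ u → 𝟙+𝟙-not (u == x)) ⟩
  ∑[ u < n ] 1 ∸ 1          ≡⟨ cong (_∸ 1) (∑-const-1 n) ⟩
  n ∸ 1                     ∎
  where
  open ≡-Reasoning
  ∑≢ : ℕ
  ∑≢ = ∑[ u < n ] 𝟙 (not (u == x))

deg≡∑ : ∀ {n} (G : Graph n) v → deg G v ≡ ∑[ u < n ] 𝟙 (adj G v u)
deg≡∑ {n} G v = sum-map-allFin {n} (λ u → 𝟙 (adj G v u))

adj-𝟙≤ : ∀ {n} (G : Graph n) v u → 𝟙 (adj G v u) ≤ 𝟙 (not (u == v))
adj-𝟙≤ G v u with u ≟ v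
... | yes refl = ≤-reflexive (cong 𝟙 (irref G v))
... | no _     = 𝟙≤1 (adj G v u)

deg≤n∸1 : ∀ {n} (G : Graph n) v → deg G v ≤ n ∸ 1
deg≤n∸1 G v = subst₂ _≤_ (sym (deg≡∑ G v)) (∑-𝟙-≢ v) (∑-mono-≤ (adj-𝟙≤ G v))

Universal : ∀ {n} → Graph n → Fin n → Set
Universal {n} G c = ∀ v → v ≢ c → adj G c v ≡ true

deg-universal : ∀ {n} (G : Graph n) {c} → Universal G c → deg G c ≡ n ∸ 1
deg-universal G {c} univ = trans (deg≡∑ G c) (trans (sum-cong-≗ adj≡) (∑-𝟙-≢ c))
  where
  adj≡ : ∀ u → 𝟙 (adj G c u) ≡ 𝟙 (not (u == c))
  adj≡ u with u ≟ c
  ... | yes refl = cong 𝟙 (irref G c)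
  ... | no u≢c   = cong 𝟙 (univ u u≢c)

foldr-⊔-lub : ∀ {m} {xs : List ℕ} → All (_≤ m) xs → Data.List.foldr _⊔_ 0 xs ≤ m
foldr-⊔-lub []         = z≤n
foldr-⊔-lub (x≤m ∷ xs≤m) = ⊔-lub x≤m (foldr-⊔-lub xs≤m)

foldr-⊔-upper : ∀ {x} {xs : List ℕ} → x ∈ xs → x ≤ Data.List.foldr _⊔_ 0 xs
foldr-⊔-upper (here refl) = m≤m⊔n _ _
foldr-⊔-upper (there x∈xs) = ≤-trans (foldr-⊔-upper x∈xs) (m≤n⊔m _ _)

maxDeg-universal : ∀ {n} (G : Graph n) {c} → Universal G c → maxDeg G ≡ n ∸ 1
maxDeg-universal {n} G {c} univ = ≤-antisym
  (foldr-⊔-lub (All.map⁺ (All.tabulate⁺ (deg≤n∸1 G))))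
  (subst (_≤ maxDeg G) (deg-universal G univ) (foldr-⊔-upper (∈-map⁺ (deg G) (∈-allFin c))))

when-< : ∀ {n} → Fin n → Fin n → ℕ → ℕ
when-< i j k = if ⌊ toℕ i <? toℕ j ⌋ then k else 0

edges≡∑ : ∀ {n} (G : Graph n) → edges G ≡ ∑[ i < n ] ∑[ j < n ] when-< i j (𝟙 (adj G i j))
edges≡∑ {n} G = begin
  edges G                                               ≡⟨ sum-concatMap row (allFin n) ⟩
  List.sum (map (List.sum ∘ row) (allFin n))            ≡⟨ sum-map-allFin {n} (List.sum ∘ row) ⟩
  ∑[ i < n ] List.sum (row i)
    ≡⟨ sum-cong-≗ {n} (λ i → sum-map-allFin {n} (λ j → when-< i j (𝟙 (adj G i j)))) ⟩
  ∑[ i < n ] ∑[ j < n ] when-< i j (𝟙 (adj G i j))       ∎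
  where
  open ≡-Reasoning
  row : Fin n → List ℕ
  row i = map (λ j → when-< i j (𝟙 (adj G i j))) (allFin n)

when-<-split : ∀ {n} (f : Fin n → Fin n → ℕ) → (∀ i → f i i ≡ 0) →
              ∀ i j → f i j ≡ when-< i j (f i j) + when-< j i (f i j)
when-<-split f f-diag i j with toℕ i <? toℕ j | toℕ j <? toℕ i
... | yes i<j | yes j<i = ⊥-elim (<-asym i<j j<i)
... | yes _   | no _    = sym (+-identityʳ _)
... | no _    | yes _   = refl
... | no i≮j  | no j≮i with toℕ-injective (≤-antisym (≮⇒≥ j≮i) (≮⇒≥ i≮j))
...   | refl = f-diag i

∑∑-symmetric : ∀ {n} (f : Fin n → Fin n → ℕ) → (∀ i j → f i j ≡ f j i) → (∀ i → f i i ≡ 0) →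
               ∑[ i < n ] ∑[ j < n ] f i j ≡ 2 * ∑[ i < n ] ∑[ j < n ] when-< i j (f i j)
∑∑-symmetric {n} f f-sym f-diag = begin
  ∑[ i < n ] ∑[ j < n ] f i j
    ≡⟨ sum-cong-≗ {n} (λ i → trans (sum-cong-≗ {n} (when-<-split f f-diag i)) (∑-distrib-+ {n} _ _)) ⟩
  ∑[ i < n ] (∑[ j < n ] when-< i j (f i j) + ∑[ j < n ] when-< j i (f i j))
    ≡⟨ ∑-distrib-+ {n} _ _ ⟩
  upper + ∑[ i < n ] ∑[ j < n ] when-< j i (f i j)
    ≡⟨ cong (upper +_) (trans (∑-comm {n} {n} _)
                              (sum-cong-≗ {n} λ j → sum-cong-≗ {n} λ i → cong (when-< j i) (f-sym i j))) ⟩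
  upper + upper
    ≡⟨ cong (upper +_) (+-identityʳ upper) ⟨
  2 * upper ∎
  where
  open ≡-Reasoning
  upper : ℕ
  upper = ∑[ i < n ] ∑[ j < n ] when-< i j (f i j)

degree-sum : ∀ {n} (G : Graph n) → ∑[ v < n ] deg G v ≡ 2 * edges G
degree-sum {n} G = begin
  ∑[ v < n ] deg G v                                 ≡⟨ sum-cong-≗ {n} (deg≡∑ G) ⟩
  ∑[ i < n ] ∑[ j < n ] 𝟙 (adj G i j)
    ≡⟨ ∑∑-symmetric _ (λ i j → cong 𝟙 (adj-sym G i j)) (λ i → cong 𝟙 (irref G i)) ⟩
  2 * ∑[ i < n ] ∑[ j < n ] when-< i j (𝟙 (adj G i j)) ≡⟨ cong (2 *_) (edges≡∑ G) ⟨
  2 * edges G                                        ∎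
  where open ≡-Reasoning

minimal-witness : (P : ℕ → Set) → (∀ k → Dec (P k)) → ∀ {k} → P k →
                  Σ ℕ λ j → P j × (∀ i → P i → j ≤ i)
minimal-witness P P? {k} Pk with P? 0
... | yes P0 = 0 , P0 , λ _ _ → z≤n
... | no ¬P0 with k
...   | zero  = ⊥-elim (¬P0 Pk)
...   | suc k with minimal-witness (P ∘ suc) (P? ∘ suc) Pk
...     | j , Pj , min = suc j , Pj , λ { zero P0 → ⊥-elim (¬P0 P0) ; (suc i) Pi → s≤s (min i Pi) }

reach? : ∀ {n} (T : Graph n) k u v → Dec (Reach T k u v)
reach? T zero    u v = u ≟ v
reach? T (suc k) u v = u ≟ v ⊎-dec any? (λ w → adj T u w Bool.≟ true ×-dec reach? T k w v)

module RootedTree {n} (T : Graph n) (connected : Connected T) (tree-size : edges T ≡ n ∸ 1)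
                  (root : Fin n) where

  private
    depth-witness : ∀ v → Σ ℕ λ k → Reach T k v root × (∀ i → Reach T i v root → k ≤ i)
    depth-witness v = minimal-witness (λ k → Reach T k v root) (λ k → reach? T k v root) (proj₂ (connected v root))

  depth : Fin n → ℕ
  depth v = proj₁ (depth-witness v)

  private
    descent : ∀ v → v ≢ root → Σ (Fin n) λ w → adj T v w ≡ true × depth w < depth v
    descent v v≢root = step (depth v) (proj₁ (proj₂ (depth-witness v))) ≤-refl
      where
      step : ∀ k → Reach T k v root → k ≤ depth v → Σ (Fin n) λ w → adj T v w ≡ true × depth w < depth v
      step zero    v≡root                  _ = ⊥-elim (v≢root v≡root)
      step (suc k) (inj₁ v≡root)           _ = ⊥-elim (v≢root v≡root)
      step (suc k) (inj₂ (w , vw , reach)) k<depth =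
        w , vw , <-≤-trans (s≤s (proj₂ (proj₂ (depth-witness w)) k reach)) k<depth

    parent-by : ∀ v → Dec (v ≡ root) → Fin n
    parent-by v (yes _)      = root
    parent-by v (no v≢root)  = proj₁ (descent v v≢root)

    parent-by-spec : ∀ v (v≟root : Dec (v ≡ root)) → v ≢ root →
                     adj T v (parent-by v v≟root) ≡ true × depth (parent-by v v≟root) < depth v
    parent-by-spec v (yes v≡root) v≢root = ⊥-elim (v≢root v≡root)
    parent-by-spec v (no v≢root)  _      = proj₂ (descent v v≢root)

  -- Abstract, so that case splits on v ≟ root elsewhere leave parent alone.
  abstract
    parent : Fin n → Fin n
    parent v = parent-by v (v ≟ root)

    parent-spec : ∀ v → v ≢ root → adj T v (parent v) ≡ true × depth (parent v) < depth v
    parent-spec v = parent-by-spec v (v ≟ root)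

  ParentOf : Fin n → Fin n → Set
  ParentOf u v = v ≢ root × u ≡ parent v

  parent-edge : ∀ {u v} → ParentOf u v → adj T u v ≡ true
  parent-edge {u} {v} (v≢root , refl) = trans (adj-sym T (parent v) v) (proj₁ (parent-spec v v≢root))

  parent-shallower : ∀ {u v} → ParentOf u v → depth u < depth v
  parent-shallower {v = v} (v≢root , refl) = proj₂ (parent-spec v v≢root)

  parent-unique : ∀ {u u′ v} → ParentOf u v → ParentOf u′ v → u ≡ u′
  parent-unique (_ , refl) (_ , refl) = refl

  root-orphan : ∀ {u} → ¬ ParentOf u root
  root-orphan (root≢root , _) = root≢root refl

  -- Comparing parent links with tree edges: both number 2(n − 1) when counted in both
  -- directions, and each parent link is an edge, so every edge is a parent link.
  private
    link : Fin n → Fin n → ℕ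
    link u v = 𝟙 (not (v == root) ∧ (u == parent v))

    link-view : ∀ u v → link u v ≡ 0 ⊎ (ParentOf u v × link u v ≡ 1)
    link-view u v with v ≟ root | u ≟ parent v
    ... | yes _      | _        = inj₁ refl
    ... | no v≢root  | yes u≡pv = inj₂ ((v≢root , u≡pv) , refl)
    ... | no _       | no _     = inj₁ refl

    links-into : ∀ v → ∑[ u < n ] link u v ≡ 𝟙 (not (v == root))
    links-into v with v ≟ root
    ... | yes _ = sum-replicate-zero n
    ... | no _  = ∑-𝟙-≡ (parent v)

    link-count : ∑[ u < n ] ∑[ v < n ] link u v ≡ n ∸ 1
    link-count = trans (∑-comm {n} {n} link) (trans (sum-cong-≗ {n} links-into) (∑-𝟙-≢ root))

    undirected-link : Fin n → Fin n → ℕ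
    undirected-link u v = link u v + link v u

    undirected-link-count : ∑[ u < n ] ∑[ v < n ] undirected-link u v ≡ 2 * (n ∸ 1)
    undirected-link-count = begin
      ∑[ u < n ] ∑[ v < n ] undirected-link u v
        ≡⟨ sum-cong-≗ {n} (λ u → ∑-distrib-+ {n} (link u) (λ v → link v u)) ⟩
      ∑[ u < n ] (∑[ v < n ] link u v + ∑[ v < n ] link v u)
        ≡⟨ ∑-distrib-+ {n} _ _ ⟩
      ∑[ u < n ] ∑[ v < n ] link u v + ∑[ u < n ] ∑[ v < n ] link v u
        ≡⟨ cong₂ _+_ link-count (trans (∑-comm {n} {n} (λ u v → link v u)) link-count) ⟩
      (n ∸ 1) + (n ∸ 1)
        ≡⟨ cong ((n ∸ 1) +_) (+-identityʳ (n ∸ 1)) ⟨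
      2 * (n ∸ 1) ∎
      where open ≡-Reasoning

    edge-count : ∑[ u < n ] ∑[ v < n ] 𝟙 (adj T u v) ≡ 2 * (n ∸ 1)
    edge-count = trans (sum-cong-≗ {n} (sym ∘ deg≡∑ T)) (trans (degree-sum T) (cong (2 *_) tree-size))

    no-mutual-parents : ∀ {u v} → ParentOf u v → ParentOf v u → ⊥
    no-mutual-parents uv vu = <-asym (parent-shallower uv) (parent-shallower vu)

    undirected-link≤edge : ∀ u v → undirected-link u v ≤ 𝟙 (adj T u v)
    undirected-link≤edge u v with link-view u v | link-view v u
    ... | inj₁ uv≡0        | inj₁ vu≡0 rewrite uv≡0 | vu≡0 = z≤n
    ... | inj₂ (uv , uv≡1) | inj₁ vu≡0 rewrite uv≡1 | vu≡0 | parent-edge uv = ≤-refl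
    ... | inj₁ uv≡0 | inj₂ (vu , vu≡1) rewrite uv≡0 | vu≡1 | adj-sym T u v | parent-edge vu = ≤-refl
    ... | inj₂ (uv , _)    | inj₂ (vu , _) = ⊥-elim (no-mutual-parents uv vu)

    undirected-link≡edge : ∀ u v → undirected-link u v ≡ 𝟙 (adj T u v)
    undirected-link≡edge u = ∑-tight (undirected-link≤edge u)
      (∑-tight (λ u → ∑-mono-≤ (undirected-link≤edge u)) (trans undirected-link-count (sym edge-count)) u)

  tree-edge : ∀ {u v} → adj T u v ≡ true → ParentOf u v ⊎ ParentOf v u
  tree-edge {u} {v} uv with link-view u v | link-view v u | undirected-link≡edge u v
  ... | inj₂ (parent-uv , _) | _ | _ = inj₁ parent-uv
  ... | inj₁ _ | inj₂ (parent-vu , _) | _ = inj₂ parent-vu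
  ... | inj₁ uv≡0 | inj₁ vu≡0 | links≡edge
    with () ← trans (sym (cong₂ _+_ uv≡0 vu≡0)) (trans links≡edge (cong 𝟙 uv))

  data Kin (u v : Fin n) : Set where
    parent-of      : ParentOf u v → Kin u v
    child-of       : ParentOf v u → Kin u v
    sibling-of     : ∀ {w} → ParentOf w u → ParentOf w v → Kin u v
    grandparent-of : ∀ {w} → ParentOf u w → ParentOf w v → Kin u v
    grandchild-of  : ∀ {w} → ParentOf v w → ParentOf w u → Kin u v

  kin : ∀ {u v} → Reach T 2 u v → u ≢ v → Kin u v
  kin (inj₁ u≡v) u≢v = ⊥-elim (u≢v u≡v)
  kin (inj₂ (w , uw , inj₁ refl)) _ with tree-edge uw
  ... | inj₁ uw′ = parent-of uw′
  ... | inj₂ wu  = child-of wu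
  kin (inj₂ (w , uw , inj₂ (v , wv , refl))) u≢v with tree-edge uw | tree-edge wv
  ... | inj₁ uw′ | inj₁ wv′ = grandparent-of uw′ wv′
  ... | inj₁ uw′ | inj₂ vw  = ⊥-elim (u≢v (parent-unique uw′ vw))
  ... | inj₂ wu  | inj₁ wv′ = sibling-of wu wv′
  ... | inj₂ wu  | inj₂ vw  = grandchild-of vw wu

ClosedNbr : ∀ {n} → Graph n → Fin n → Fin n → Set
ClosedNbr G c v = v ≡ c ⊎ adj G c v ≡ true

module _ {n} (T : Graph n) (connected : Connected T) (tree-size : edges T ≡ n ∸ 1)
         (K : Fin n → Bool) (close : ∀ u v → K u ≡ true → K v ≡ true → u ≢ v → Reach T 2 u v)
         {r : Fin n} (Kr : K r ≡ true) where

  open RootedTree T connected tree-size r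

  private
    depth≤2 : ∀ {q} → K q ≡ true → q ≢ r → ParentOf r q ⊎ Σ (Fin n) λ w → ParentOf r w × ParentOf w q
    depth≤2 {q} Kq q≢r with kin (close r q Kr Kq (q≢r ∘ sym)) (q≢r ∘ sym)
    ... | parent-of rq         = inj₁ rq
    ... | child-of qr          = ⊥-elim (root-orphan qr)
    ... | sibling-of wr _      = ⊥-elim (root-orphan wr)
    ... | grandparent-of rw wq = inj₂ (_ , rw , wq)
    ... | grandchild-of _ wr   = ⊥-elim (root-orphan wr)

    star-below-root : ∀ {g w} → K g ≡ true → ParentOf r w → ParentOf w g → ∀ q → K q ≡ true → ClosedNbr T w q
    star-below-root {g} {w} Kg rw wg q Kq with q ≟ r | q ≟ g
    ... | yes refl | _        = inj₂ (trans (adj-sym T w r) (parent-edge rw))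
    ... | no _     | yes refl = inj₂ (parent-edge wg)
    ... | no q≢r   | no q≢g   with kin (close q g Kq Kg q≢g) q≢g
    ...   | parent-of qg = inj₁ (parent-unique qg wg)
    ...   | child-of gq with depth≤2 Kq q≢r
    ...     | inj₁ rq = ⊥-elim (proj₁ wg (parent-unique gq rq))
    ...     | inj₂ (_ , rw′ , w′q) with parent-unique gq w′q
    ...       | refl = ⊥-elim (proj₁ rw (sym (parent-unique rw′ wg)))
    star-below-root {g} {w} Kg rw wg q Kq | no q≢r | no q≢g | sibling-of w′q w′g with parent-unique w′g wg
    ... | refl = inj₂ (parent-edge w′q)
    star-below-root {g} {w} Kg rw wg q Kq | no q≢r | no q≢g | grandparent-of qw′ w′g with parent-unique w′g wg
    ... | refl = ⊥-elim (q≢r (parent-unique qw′ rw))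
    star-below-root {g} {w} Kg rw wg q Kq | no q≢r | no q≢g | grandchild-of gw′ w′q with depth≤2 Kq q≢r
    ... | inj₁ rq = ⊥-elim (proj₁ gw′ (parent-unique w′q rq))
    ... | inj₂ (_ , rw″ , w″q) with parent-unique w″q w′q
    ...   | refl = ⊥-elim (proj₁ wg (parent-unique gw′ rw″))

  diameter-two⇒closed-star : Σ (Fin n) λ c → ∀ q → K q ≡ true → ClosedNbr T c q
  diameter-two⇒closed-star with any? (λ g → K g Bool.≟ true ×-dec ¬? (g ≟ r) ×-dec ¬? (r ≟ parent g))
  ... | yes (g , Kg , g≢r , r≢pg) with depth≤2 Kg g≢r
  ...   | inj₁ (_ , r≡pg)      = ⊥-elim (r≢pg r≡pg)
  ...   | inj₂ (w , rw , wg)   = w , star-below-root Kg rw wg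
  diameter-two⇒closed-star | no ¬deep = r , star-at-root
    where
    star-at-root : ∀ q → K q ≡ true → ClosedNbr T r q
    star-at-root q Kq with q ≟ r | r ≟ parent q
    ... | yes q≡r | _        = inj₁ q≡r
    ... | no q≢r  | yes r≡pq = inj₂ (parent-edge (q≢r , r≡pq))
    ... | no q≢r  | no r≢pq  = ⊥-elim (¬deep (q , Kq , q≢r , r≢pq))

second-neighbour : ∀ {n} (G : Graph n) → (∀ v → deg G v ≢ 1) →
                   ∀ {v w} → adj G v w ≡ true → ∀ x → Σ (Fin n) λ u → adj G v u ≡ true × u ≢ x
second-neighbour {n} G no-pendant {v} {w} vw x
  with any? (λ u → adj G v u Bool.≟ true ×-dec ¬? (u ≟ x))
... | yes (u , vu , u≢x) = u , vu , u≢x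
... | no ¬other with w ≟ x
...   | no w≢x  = ⊥-elim (¬other (w , vw , w≢x))
...   | yes refl = ⊥-elim (no-pendant v (trans (deg≡∑ G v) (trans (∑-pick _ w only-w) (cong 𝟙 vw))))
  where
  only-w : ∀ u → u ≢ w → 𝟙 (adj G v u) ≡ 0
  only-w u u≢w with adj G v u in vu
  ... | true  = ⊥-elim (¬other (u , vu , u≢w))
  ... | false = refl

module _ {n} {H : Graph n} {inQ : Fin n → Bool} (split : SplitPartition H inQ)
         {T : Graph n} (T⊆H : T ⊆ᴳ H) (connected : Connected T) (tree-size : edges T ≡ n ∸ 1)
         (spanner : ∀ u v → adj H u v ≡ true → Reach T 2 u v) (no-pendant : ∀ v → deg H v ≢ 1) where

  open SplitPartition split

  private
    Q≢S : ∀ {u v} → inQ u ≡ true → inQ v ≡ false → u ≢ v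
    Q≢S Qu Sv refl = true≢false (trans (sym Qu) Sv)

    S-neighbour-in-Q : ∀ {u v} → inQ u ≡ false → adj H u v ≡ true → inQ v ≡ true
    S-neighbour-in-Q {u} {v} Su uv with inQ v in Qv
    ... | true  = refl
    ... | false = ⊥-elim (true≢false (trans (sym uv) (independent u v Su Qv)))

    module Centre {s} (Ss : inQ s ≡ false) where
      closed-star : Σ (Fin n) λ c → ∀ q → inQ q ≡ true → ClosedNbr T c q
      closed-star = diameter-two⇒closed-star T connected tree-size inQ
        (λ u v Qu Qv u≢v → spanner u v (clique u v Qu Qv u≢v)) (proj₁ (proj₂ (maximal s Ss)))

      c : Fin n
      c = proj₁ closed-star

      star : ∀ q → inQ q ≡ true → ClosedNbr T c q
      star = proj₂ closed-star

      Qc : inQ c ≡ true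
      Qc with inQ c in Sc
      ... | true  = refl
      ... | false with maximal c Sc
      ...   | q , Qq , cq≢ with star q Qq
      ...     | inj₁ q≡c = ⊥-elim (Q≢S Qq Sc q≡c)
      ...     | inj₂ cq  = ⊥-elim (true≢false (trans (sym (T⊆H c q cq)) cq≢))

      open RootedTree T connected tree-size c

      Q-children : ∀ {q} → inQ q ≡ true → q ≢ c → ParentOf c q
      Q-children {q} Qq q≢c with star q Qq
      ... | inj₁ q≡c = ⊥-elim (q≢c q≡c)
      ... | inj₂ cq with tree-edge cq
      ...   | inj₁ c-q = c-q
      ...   | inj₂ q-c = ⊥-elim (root-orphan q-c)

      H-parent-edge : ∀ {v} → v ≢ c → adj H v (parent v) ≡ true
      H-parent-edge {v} v≢c = T⊆H v (parent v) (proj₁ (parent-spec v v≢c))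

      S-neighbour-child : ∀ {v u} → inQ v ≡ false → adj H v u ≡ true → u ≢ c → ParentOf c u
      S-neighbour-child Sv vu = Q-children (S-neighbour-in-Q Sv vu)

      -- All neighbours of v lie in Q, hence in the star of c; two of them other than c would
      -- be children of c, so v, hanging below one of them, is too far from the other.
      other-neighbour≡c : ∀ {v u} → inQ v ≡ false → v ≢ c → parent v ≢ c →
                          adj H v u ≡ true → u ≢ parent v → u ≡ c
      other-neighbour≡c {v} {u} Sv v≢c p≢c vu u≢p with u ≟ c
      ... | yes u≡c = u≡c
      ... | no u≢c with kin (spanner v u vu) (Q≢S (S-neighbour-in-Q Sv vu) Sv ∘ sym)
      ...   | parent-of vu′ = ⊥-elim (v≢c (parent-unique vu′ (S-neighbour-child Sv vu u≢c)))
      ...   | child-of uv   = ⊥-elim (u≢p (parent-unique uv (v≢c , refl)))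
      ...   | sibling-of wv wu =
                ⊥-elim (p≢c (trans (parent-unique (v≢c , refl) wv) (parent-unique wu (S-neighbour-child Sv vu u≢c))))
      ...   | grandparent-of vw wu with parent-unique wu (S-neighbour-child Sv vu u≢c)
      ...     | refl = ⊥-elim (root-orphan vw)
      other-neighbour≡c {v} {u} Sv v≢c p≢c vu u≢p | no u≢c | grandchild-of uw wv
        with parent-unique wv (v≢c , refl)
      ... | refl = ⊥-elim (u≢c (parent-unique uw (S-neighbour-child Sv (H-parent-edge v≢c) p≢c)))

      S-adjacent : ∀ {v} → inQ v ≡ false → v ≢ c → adj H c v ≡ true
      S-adjacent {v} Sv v≢c with parent v ≟ c
      ... | yes p≡c = trans (adj-sym H c v) (subst (λ w → adj H v w ≡ true) p≡c (H-parent-edge v≢c))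
      ... | no p≢c with second-neighbour H no-pendant (H-parent-edge v≢c) (parent v)
      ...   | u , vu , u≢p with other-neighbour≡c Sv v≢c p≢c vu u≢p
      ...     | refl = trans (adj-sym H c v) vu

      universal : Universal H c
      universal v v≢c with inQ v in Qv
      ... | true  = clique c v Qc Qv (v≢c ∘ sym)
      ... | false = S-adjacent Qv v≢c

  split-tree-2-spanner⇒universal : ∀ {s} → inQ s ≡ false → Σ (Fin n) (Universal H)
  split-tree-2-spanner⇒universal Ss = Centre.c Ss , Centre.universal Ss

module Completion {n} (x : Fin n) (N : Fin n → Bool) (Nx : N x ≡ false) where

  private
    adjᶜ : Fin n → Fin n → Bool
    adjᶜ u v = if u == x then N v else if v == x then N u else not (u == v)

    adjᶜ-sym : ∀ u v → adjᶜ u v ≡ adjᶜ v u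
    adjᶜ-sym u v with u ≟ x | v ≟ x
    ... | yes refl | yes refl = refl
    ... | yes _    | no _     = refl
    ... | no _     | yes _    = refl
    ... | no _     | no _     = cong not (==-sym u v)

    adjᶜ-irrefl : ∀ v → adjᶜ v v ≡ false
    adjᶜ-irrefl v with v ≟ x
    ... | yes refl = Nx
    ... | no _     = cong not (dec-true (v ≟ v) refl)

  completion : Graph n
  completion = record { adj = adjᶜ ; sym = adjᶜ-sym ; irref = adjᶜ-irrefl }

  completion-⊇ : (H : Graph n) → (∀ v → adj H x v ≡ true → N v ≡ true) → H ⊆ᴳ completion
  completion-⊇ H N⊇ u v uv with u ≟ x | v ≟ x
  ... | yes refl | _        = N⊇ v uv
  ... | no _     | yes refl = N⊇ u (trans (adj-sym H x u) uv)
  ... | no _     | no _     = cong not (dec-false (u ≟ v) λ { refl → true≢false (trans (sym uv) (irref H u)) })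

  completion-clique : ∀ u v → u ≢ x → v ≢ x → u ≢ v → adj completion u v ≡ true
  completion-clique u v u≢x v≢x u≢v
    rewrite dec-false (u ≟ x) u≢x | dec-false (v ≟ x) v≢x | dec-false (u ≟ v) u≢v = refl

  completion-apex-loopless : ∀ v → adj completion x v ≡ true → v ≢ x
  completion-apex-loopless v xv refl rewrite dec-true (x ≟ x) refl with () ← trans (sym Nx) xv

  size : ℕ
  size = ∑[ v < n ] 𝟙 (N v)

  private
    apex-row : ∀ u → 𝟙 (adjᶜ x u) ≡ 𝟙 (N u)
    apex-row u rewrite dec-true (x ≟ x) refl = refl

    other-row : ∀ {v} → v ≢ x → ∀ u →
                𝟙 (adjᶜ v u) + 𝟙 (u == v) ≡ 𝟙 (not (u == x)) + 𝟙 (u == x) * 𝟙 (N v)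
    other-row {v} v≢x u rewrite dec-false (v ≟ x) v≢x with u ≟ x | u ≟ v
    ... | yes refl | yes x≡v  = ⊥-elim (v≢x (sym x≡v))
    ... | yes refl | no _     = refl
    ... | no _     | yes refl rewrite dec-true (u ≟ u) refl = refl
    ... | no _     | no u≢v   rewrite dec-false (v ≟ u) (u≢v ∘ sym) = refl

  deg-apex : deg completion x ≡ size
  deg-apex = trans (deg≡∑ completion x) (sum-cong-≗ {n} apex-row)

  deg-other : ∀ {v} → v ≢ x → deg completion v + 1 ≡ (n ∸ 1) + 𝟙 (N v)
  deg-other {v} v≢x = begin
    deg completion v + 1
      ≡⟨ cong₂ _+_ (deg≡∑ completion v) (sym (∑-𝟙-≡ v)) ⟩
    ∑[ u < n ] 𝟙 (adjᶜ v u) + ∑[ u < n ] 𝟙 (u == v)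
      ≡⟨ ∑-distrib-+ {n} _ _ ⟨
    ∑[ u < n ] (𝟙 (adjᶜ v u) + 𝟙 (u == v))
      ≡⟨ sum-cong-≗ {n} (other-row v≢x) ⟩
    ∑[ u < n ] (𝟙 (not (u == x)) + 𝟙 (u == x) * 𝟙 (N v))
      ≡⟨ ∑-distrib-+ {n} _ _ ⟩
    ∑[ u < n ] 𝟙 (not (u == x)) + ∑[ u < n ] (𝟙 (u == x) * 𝟙 (N v))
      ≡⟨ cong₂ _+_ (∑-𝟙-≢ x) (trans (∑-scale (λ u → 𝟙 (u == x)) (𝟙 (N v))) (cong (_* 𝟙 (N v)) (∑-𝟙-≡ x))) ⟩
    (n ∸ 1) + 1 * 𝟙 (N v)
      ≡⟨ cong ((n ∸ 1) +_) (*-identityˡ _) ⟩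
    (n ∸ 1) + 𝟙 (N v) ∎
    where open ≡-Reasoning

  private
    deg-uniform : ∀ v → deg completion v + 𝟙 (not (v == x)) ≡
                        𝟙 (v == x) * size + 𝟙 (not (v == x)) * (n ∸ 1) + 𝟙 (N v)
    deg-uniform v = by-cases (v ≟ x)
      where
      by-cases : (v≟x : Dec (v ≡ x)) → deg completion v + 𝟙 (not (does v≟x)) ≡
                 𝟙 (does v≟x) * size + 𝟙 (not (does v≟x)) * (n ∸ 1) + 𝟙 (N v)
      by-cases (yes refl) = begin
        deg completion x + 0                   ≡⟨ +-identityʳ _ ⟩
        deg completion x                       ≡⟨ deg-apex ⟩
        size                                   ≡⟨ +-identityʳ size ⟨
        size + 0                               ≡⟨ cong₂ _+_ (trans (+-identityʳ _) (+-identityʳ size)) (cong 𝟙 Nx) ⟨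
        1 * size + 0 * (n ∸ 1) + 𝟙 (N x)        ∎
        where open ≡-Reasoning
      by-cases (no v≢x) = trans (deg-other v≢x) (cong (_+ 𝟙 (N v)) (sym (+-identityʳ (n ∸ 1))))

  edges-completion : 2 * edges completion + (n ∸ 1) ≡ size + (n ∸ 1) * (n ∸ 1) + size
  edges-completion = begin
    2 * edges completion + (n ∸ 1)
      ≡⟨ cong₂ _+_ (degree-sum completion) (∑-𝟙-≢ x) ⟨
    ∑[ v < n ] deg completion v + ∑[ v < n ] 𝟙 (not (v == x))
      ≡⟨ ∑-distrib-+ {n} _ _ ⟨
    ∑[ v < n ] (deg completion v + 𝟙 (not (v == x)))
      ≡⟨ sum-cong-≗ {n} deg-uniform ⟩
    ∑[ v < n ] (𝟙 (v == x) * size + 𝟙 (not (v == x)) * (n ∸ 1) + 𝟙 (N v))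
      ≡⟨ trans (∑-distrib-+ {n} _ _) (cong (_+ size) (∑-distrib-+ {n} _ _)) ⟩
    ∑[ v < n ] (𝟙 (v == x) * size) + ∑[ v < n ] (𝟙 (not (v == x)) * (n ∸ 1)) + size
      ≡⟨ cong (λ k → k + size)
           (cong₂ _+_ (trans (∑-scale (λ v → 𝟙 (v == x)) size) (cong (_* size) (∑-𝟙-≡ x)))
                      (trans (∑-scale (λ v → 𝟙 (not (v == x))) (n ∸ 1)) (cong (_* (n ∸ 1)) (∑-𝟙-≢ x)))) ⟩
    1 * size + (n ∸ 1) * (n ∸ 1) + size
      ≡⟨ cong (λ k → k + (n ∸ 1) * (n ∸ 1) + size) (*-identityˡ size) ⟩
    size + (n ∸ 1) * (n ∸ 1) + size ∎
    where open ≡-Reasoning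

discrete-ivt : (f : ℕ → ℕ) → (∀ t → f (suc t) ≤ suc (f t)) →
               ∀ {m} K → f 0 ≤ m → m ≤ f K → Σ ℕ λ t → f t ≡ m
discrete-ivt f step zero    f0≤m m≤fK = 0 , ≤-antisym f0≤m m≤fK
discrete-ivt f step {m} (suc K) f0≤m m≤fK with m ≤? f K
... | yes m≤fK′ = discrete-ivt f step K f0≤m m≤fK′
... | no  m≰fK′ = suc K , ≤-antisym (≤-trans (step K) (≰⇒> m≰fK′)) m≤fK

<ᵇ-suc : ∀ a t → 𝟙 (a <ᵇ suc t) ≤ 𝟙 (a <ᵇ t) + 𝟙 (a ≡ᵇ t)
<ᵇ-suc zero    zero    = ≤-refl
<ᵇ-suc zero    (suc t) = s≤s z≤n
<ᵇ-suc (suc a) zero    = z≤n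
<ᵇ-suc (suc a) (suc t) = <ᵇ-suc a t

∑-toℕ≡ᵇ : ∀ {n} t → ∑[ v < n ] 𝟙 (toℕ v ≡ᵇ t) ≤ 1
∑-toℕ≡ᵇ {zero}  t       = z≤n
∑-toℕ≡ᵇ {suc n} zero    = ≤-reflexive (cong suc (sum-replicate-zero n))
∑-toℕ≡ᵇ {suc n} (suc t) = ∑-toℕ≡ᵇ {n} t

∧-∨-mono : ∀ a b {c d} k → 𝟙 c ≤ 𝟙 d + k → 𝟙 (a ∧ (b ∨ c)) ≤ 𝟙 (a ∧ (b ∨ d)) + k
∧-∨-mono false b     k _   = z≤n
∧-∨-mono true  true  k _   = s≤s z≤n
∧-∨-mono true  false k c≤d = c≤d

-- t ↦ padded-size t climbs in unit steps from deg x (t = 0) to n − 1 (t = n), so it takes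
-- every value in between.
module Padding {n} (H : Graph n) (x : Fin n) where

  padded : ℕ → Fin n → Bool
  padded t v = not (v == x) ∧ (adj H x v ∨ (toℕ v <ᵇ t))

  padded-size : ℕ → ℕ
  padded-size t = ∑[ v < n ] 𝟙 (padded t v)

  private
    size-0 : padded-size 0 ≡ deg H x
    size-0 = trans (sum-cong-≗ {n} row) (sym (deg≡∑ H x))
      where
      row : ∀ v → 𝟙 (padded 0 v) ≡ 𝟙 (adj H x v)
      row v with v ≟ x
      ... | yes refl = cong 𝟙 (sym (irref H v))
      ... | no _     = cong 𝟙 (Bool.∨-identityʳ (adj H x v))

    size-n : padded-size n ≡ n ∸ 1
    size-n = trans (sum-cong-≗ {n} row) (∑-𝟙-≢ x)
      where
      row : ∀ v → 𝟙 (padded n v) ≡ 𝟙 (not (v == x))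
      row v with toℕ v <ᵇ n | <⇒<ᵇ (toℕ<n v)
      ... | true | _ = trans (cong (λ b → 𝟙 (not (v == x) ∧ b)) (Bool.∨-zeroʳ (adj H x v)))
                             (cong 𝟙 (Bool.∧-identityʳ _))

    size-step : ∀ t → padded-size (suc t) ≤ suc (padded-size t)
    size-step t = begin
      padded-size (suc t)                                          ≤⟨ ∑-mono-≤ row ⟩
      ∑[ v < n ] (𝟙 (padded t v) + 𝟙 (toℕ v ≡ᵇ t))                ≡⟨ ∑-distrib-+ {n} _ _ ⟩
      padded-size t + ∑[ v < n ] 𝟙 (toℕ v ≡ᵇ t)                   ≤⟨ +-monoʳ-≤ (padded-size t) (∑-toℕ≡ᵇ {n} t) ⟩
      padded-size t + 1                                            ≡⟨ +-comm (padded-size t) 1 ⟩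
      suc (padded-size t)                                          ∎
      where
      open ≤-Reasoning
      row : ∀ v → 𝟙 (padded (suc t) v) ≤ 𝟙 (padded t v) + 𝟙 (toℕ v ≡ᵇ t)
      row v = ∧-∨-mono (not (v == x)) (adj H x v) _ (<ᵇ-suc (toℕ v) t)

  padding : ∀ {m} → deg H x ≤ m → m ≤ n ∸ 1 →
            Σ (Fin n → Bool) λ N → N x ≡ false × (∀ v → adj H x v ≡ true → N v ≡ true) ×
                                   ∑[ v < n ] 𝟙 (N v) ≡ m
  padding deg≤m m≤n∸1
    with discrete-ivt padded-size size-step n (subst (_≤ _) (sym size-0) deg≤m) (subst (_ ≤_) (sym size-n) m≤n∸1)
  ... | t , size≡m = padded t , apex-excluded , nbrs-included , size≡m
    where
    apex-excluded : padded t x ≡ false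
    apex-excluded rewrite dec-true (x ≟ x) refl = refl
    nbrs-included : ∀ v → adj H x v ≡ true → padded t v ≡ true
    nbrs-included v xv with v ≟ x
    ... | yes refl = ⊥-elim (true≢false (trans (sym xv) (irref H x)))
    ... | no _ rewrite xv = refl

padded-completion : ∀ {n} (H : Graph n) (x : Fin n) {m} → deg H x ≤ m → m ≤ n ∸ 1 →
  Σ (Graph n) λ H* → H ⊆ᴳ H* × (∀ u v → u ≢ x → v ≢ x → u ≢ v → adj H* u v ≡ true) ×
                      (∀ v → adj H* x v ≡ true → v ≢ x) × 2 * edges H* + (n ∸ 1) ≡ m + (n ∸ 1) * (n ∸ 1) + m
padded-completion {n} H x δ≤m m≤n∸1 with Padding.padding H x δ≤m m≤n∸1
... | N , Nx , N⊇ , size≡m =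
  completion , completion-⊇ H N⊇ , completion-clique , completion-apex-loopless ,
  subst (λ k → 2 * edges completion + (n ∸ 1) ≡ k + (n ∸ 1) * (n ∸ 1) + k) size≡m edges-completion
  where open Completion x N Nx

odd⇒pred≡2*half : ∀ n → n % 2 ≡ 1 → n ∸ 1 ≡ 2 * (n / 2)
odd⇒pred≡2*half n odd = begin
  n ∸ 1                    ≡⟨ cong (_∸ 1) (m≡m%n+[m/n]*n n 2) ⟩
  n % 2 + n / 2 * 2 ∸ 1    ≡⟨ cong (λ r → r + n / 2 * 2 ∸ 1) odd ⟩
  n / 2 * 2                ≡⟨ *-comm (n / 2) 2 ⟩
  2 * (n / 2)              ∎
  where open ≡-Reasoning

edges-from-degree-sum : ∀ e m → 2 * e + 2 * m ≡ m + 2 * m * (2 * m) + m → e ≡ 2 * m * m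
edges-from-degree-sum e m sum≡ = *-cancelˡ-≡ e (2 * m * m) 2
  (+-cancelʳ-≡ (2 * m) (2 * e) (2 * (2 * m * m)) (trans sum≡ (rearrange m)))
  where
  rearrange : ∀ m → m + 2 * m * (2 * m) + m ≡ 2 * (2 * m * m) + 2 * m
  rearrange = solve-∀

lemma1 : (n : ℕ) (H : Graph n) (inQ : Fin n → Bool) → SplitPartition H inQ →
    StretchIndexTwo H →
    (∀ v → deg H v ≢ 1) →
    ¬ Overfull H →
    n % 2 ≡ 1 →
    (s₁ : Fin n) → inQ s₁ ≡ false →
    (∀ v → deg H s₁ ≤ deg H v) →
    2 * deg H s₁ ≤ n ∸ 1 →
    Σ (Graph n) λ H* →
      (∀ u v → adj H u v ≡ true → adj H* u v ≡ true) ×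
      (∀ u v → u ≢ s₁ → v ≢ s₁ → u ≢ v → adj H* u v ≡ true) ×
      (∀ v → adj H* s₁ v ≡ true → v ≢ s₁) ×
      maxDeg H* ≡ maxDeg H ×
      edges H* ≡ maxDeg H * (n / 2)
lemma1 n H inQ split ((T , (T⊆H , connected , tree-size) , spanner) , _) no-pendant _ odd s₁ Ss₁ _ 2δ≤n∸1
  with split-tree-2-spanner⇒universal split T⊆H connected tree-size spanner no-pendant Ss₁
     | padded-completion H s₁ (*-cancelˡ-≤ 2 (subst (2 * deg H s₁ ≤_) (odd⇒pred≡2*half n odd) 2δ≤n∸1))
                              (subst (n / 2 ≤_) (sym (odd⇒pred≡2*half n odd)) (m≤m+n (n / 2) (n / 2 + 0)))
... | c , universal | H* , H⊆H* , clique , loopless , degree-sum* =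
  H* , H⊆H* , clique , loopless , trans Δ*≡n∸1 (sym Δ≡n∸1) , edges≡
  where
  m : ℕ
  m = n / 2

  n∸1≡2m : n ∸ 1 ≡ 2 * m
  n∸1≡2m = odd⇒pred≡2*half n odd

  Δ≡n∸1 : maxDeg H ≡ n ∸ 1
  Δ≡n∸1 = maxDeg-universal H universal

  Δ*≡n∸1 : maxDeg H* ≡ n ∸ 1
  Δ*≡n∸1 = maxDeg-universal H* (λ v v≢c → H⊆H* c v (universal v v≢c))

  edges≡ : edges H* ≡ maxDeg H * m
  edges≡ = begin
    edges H*      ≡⟨ edges-from-degree-sum (edges H*) m
                       (subst (λ k → 2 * edges H* + k ≡ m + k * k + m) n∸1≡2m degree-sum*) ⟩
    2 * m * m     ≡⟨ cong (_* m) (trans (sym n∸1≡2m) (sym Δ≡n∸1)) ⟩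
    maxDeg H * m  ∎
    where open ≡-Reasoning
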